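{- Let $q$ be a prime power, $\delta_i\in\mathbb{F}_{q^2}$ with $\delta_i^{q+1}=1$, $s(x)=x^q+\delta_ix$, $m$ a positive integer, $a_i\in\mathbb{F}_q$ for $2\le i\le m-1$, and $\lambda$ an element of the image of $s$ on $\mathbb{F}_{q^2}$. Put $g(y)=y^m+\sum_{i=2}^{m-1}\lambda^{m-i}a_iy^i$. Then for every linearized polynomial $L(x)$ over $\mathbb{F}_{q^2}$ of rank $2$ such that $L(\ker s)$ is contained in the $\mathbb{F}_q$-span of $\lambda^m$, the polynomial $f(x)=g(s(x))+L(x)$ is a permutation polynomial of $\mathbb{F}_{q^2}$.
   Context: A linearized polynomial over $\mathbb{F}_{q^2}$ is $L(x)=\alpha_1x^q+\alpha_0x$ with $\alpha_0,\alpha_1\in\mathbb{F}_{q^2}$; its rank, kernel and image are those of the $\mathbb{F}_q$-linear evaluation map on $\mathbb{F}_{q^2}$. A permutation polynomial of $\mathbb{F}_{q^2}$ is one whose evaluation map is a bijection. -}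

module Defs where

open import Level using (Level; _⊔_; 0ℓ)
open import Algebra.Bundles using (CommutativeRing; Semiring)
import Algebra.Definitions.RawSemiring as RawSemiringDefs
open import Data.Nat as ℕ using (ℕ; zero; suc)
open import Data.Nat.Primality using (Prime)
open import Data.Fin using (Fin)
import Data.Fin as Fin
open import Data.Product using (Σ; ∃; ∃₂; _×_; _,_)
open import Relation.Nullary using (¬_)
open import Relation.Binary.PropositionalEquality as ≡ using (_≡_)
open import Function.Bundles using (Bijection)
import Function.Definitions as FunDefs

IsPrimePower : ℕ → Set
IsPrimePower q = ∃₂ λ p k → Prime p × 1 ℕ.≤ k × q ≡ p ℕ.^ k

module _ {c ℓ : Level} (K : CommutativeRing c ℓ) where
  open CommutativeRing K
  open RawSemiringDefs (Semiring.rawSemiring semiring) using (_^_)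

  record IsField : Set (c ⊔ ℓ) where
    field
      0≉1     : ¬ (0# ≈ 1#)
      inverse : ∀ x → ¬ (x ≈ 0#) → ∃ λ y → x * y ≈ 1#

  HasCardinality : ℕ → Set (c ⊔ ℓ)
  HasCardinality n = Bijection (≡.setoid (Fin n)) setoid

  pow : Carrier → ℕ → Carrier
  pow x n = x ^ n

  sumFin : ∀ {r} → (Fin r → Carrier) → Carrier
  sumFin {zero}  f = 0#
  sumFin {suc r} f = f Fin.zero + sumFin (λ i → f (Fin.suc i))

  sumN : ℕ → (ℕ → Carrier) → Carrier
  sumN zero    f = 0#
  sumN (suc n) f = sumN n f + f n

  IsPermutation : (Carrier → Carrier) → Set (c ⊔ ℓ)
  IsPermutation f = FunDefs.Bijective _≈_ _≈_ f

  module _ (q : ℕ) where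
    -- membership in the subfield F_q = { x | x^q = x } of F_{q^2}
    InFq : Carrier → Set ℓ
    InFq x = x ^ q ≈ x

    linearized : Carrier → Carrier → Carrier → Carrier
    linearized α₁ α₀ x = α₁ * x ^ q + α₀ * x

    sPoly : Carrier → Carrier → Carrier
    sPoly δ x = x ^ q + δ * x

    gPoly : ℕ → (ℕ → Carrier) → Carrier → Carrier → Carrier
    gPoly m a λ₀ y =
      y ^ m + sumN (m ℕ.∸ 2) (λ k → (λ₀ ^ (m ℕ.∸ (2 ℕ.+ k))) * (a (2 ℕ.+ k) * y ^ (2 ℕ.+ k)))

    combo : ∀ {r} → (Fin r → Carrier) → (Fin r → Carrier) → Carrier
    combo cs v = sumFin (λ i → cs i * v i)

    LinIndepFq : ∀ {r} → (Fin r → Carrier) → Set (c ⊔ ℓ)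
    LinIndepFq {r} v = (cs : Fin r → Carrier) → (∀ i → InFq (cs i)) →
                       combo cs v ≈ 0# → ∀ i → cs i ≈ 0#

    InSpanFq : ∀ {r} → (Fin r → Carrier) → Carrier → Set (c ⊔ ℓ)
    InSpanFq {r} v y = ∃ λ (cs : Fin r → Carrier) → (∀ i → InFq (cs i)) × y ≈ combo cs v

    HasRank : (Carrier → Carrier) → ℕ → Set (c ⊔ ℓ)
    HasRank F r = Σ (Fin r → Carrier) λ v →
      LinIndepFq v × (∀ y → ((∃ λ x → F x ≈ y) → InSpanFq v y) × (InSpanFq v y → ∃ λ x → F x ≈ y))

module Submission where

-- The middle binomial coefficients of (x + y)^q vanish, so x ↦ x^q is
-- additive, and it is an involution by Fermat's little theorem for |K| = q²; F_q is its fixed field.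
-- Since δ^(q+1) = 1, every value of s satisfies s(x)^q = δ^q s(x); so does λ = s(z) ≠ 0, whence
-- s(x) = t λ with t ∈ F_q, and g(s(x)) = G(t) λ^m with G(t) ∈ F_q because the a_i lie in F_q.
-- A rank-2 L is injective (a nonzero kernel would make all of L(K) an F_q-multiple of one vector),
-- and s has a kernel vector k₀ ≠ 0 with L(k₀) = e₀ λ^m, e₀ ∈ F_q^×. If f(x) = f(y), then
-- L(x) − L(y) ∈ F_q λ^m = L(F_q k₀), so x − y ∈ F_q k₀ ⊆ ker s; thus s(x) = s(y), L(x) = L(y) and
-- x = y. An injective self-map of a finite set is bijective.

open import Defs
open import Level using (Level)
open import Algebra.Bundles using (CommutativeRing; CommutativeMonoid)
import Algebra.Properties.CommutativeMonoid.Sum as CommutativeMonoidSum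
open import Data.Nat as ℕ using (ℕ; zero; suc; _∸_; _!; _<_)
open import Data.Nat.Properties as ℕₚ using (<⇒≱; <⇒≤; n<1+n; <-trans; ∸-monoʳ-<; _!*_!≢0; n∸n≡0)
open import Data.Nat.Divisibility using (_∣_; _∤_; ∣⇒≤; m∣m*n; divides)
open import Data.Nat.DivMod using (m/n*n≡m)
open import Data.Nat.Primality using (Prime; euclidsLemma; prime⇒nonZero; prime⇒nonTrivial)
open import Data.Nat.Combinatorics using (_C_; k![n∸k]!∣n!; nCk≡n!/k![n-k]!; nCn≡1)
open import Data.Fin using (Fin; zero; suc; punchOut; punchIn; fromℕ; inject₁)
open import Data.Fin.Properties
  using (any?; punchOut-injective; punchInᵢ≢i; <⇒notInjective; ¬∀⟶∃¬; inj⇒≟; toℕ-fromℕ; toℕ-inject₁; toℕ<n)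
  renaming (_≟_ to _≟ᶠ_)
open import Data.Fin.Permutation using (Permutation; permutation)
open import Data.Maybe using (nothing)
open import Data.Product using (∃; _×_; _,_; proj₁; proj₂)
open import Data.Sum using (inj₁; inj₂)
open import Function.Base using (_∘_; id)
open import Function.Bundles using (Bijection; Inverse)
open import Function.Definitions using (Injective; Bijective; Congruent)
open import Function.Properties.Bijection using (Bijection⇒Inverse)
open import Function.Properties.Inverse using (Inverse⇒Injection)
import Function.Construct.Symmetry as Symmetry
open import Relation.Binary using (Setoid; Decidable; _Respects_)
open import Relation.Binary.PropositionalEquality as ≡ using (_≡_; _≢_)
open import Relation.Nullary using (¬_; yes; no)
open import Relation.Nullary.Negation using (contradiction)
open import Relation.Unary as U using (Pred)

Fin-injective⇒surjective : ∀ {n} (σ : Fin n → Fin n) → Injective _≡_ _≡_ σ → ∀ j → ∃ λ i → σ i ≡ j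
Fin-injective⇒surjective σ σ-injective j with any? (λ i → σ i ≟ᶠ j)
... | yes found = found
Fin-injective⇒surjective {suc n} σ σ-injective j | no ¬found =
  contradiction (λ {i i′} → ρ-injective {i} {i′}) (<⇒notInjective (n<1+n n))
  where
  j≢σ : ∀ i → j ≢ σ i
  j≢σ i j≡σi = ¬found (i , ≡.sym j≡σi)

  ρ : Fin (suc n) → Fin n
  ρ i = punchOut (j≢σ i)

  ρ-injective : Injective _≡_ _≡_ ρ
  ρ-injective = σ-injective ∘ punchOut-injective (j≢σ _) (j≢σ _)

module FiniteSetoid {a ℓ} (S : Setoid a ℓ) {N : ℕ} (enum : Bijection (≡.setoid (Fin N)) S) where
  open Setoid S renaming (Carrier to A)
  private
    module I = Inverse (Bijection⇒Inverse enum)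
  open I using (to)
  open I public using (from; strictlyInverseˡ)

  infix 4 _≟_
  _≟_ : Decidable _≈_
  _≟_ = inj⇒≟ (Inverse⇒Injection (Symmetry.inverse (Bijection⇒Inverse enum)))

  from-injective : ∀ {x y} → from x ≡ from y → x ≈ y
  from-injective {x} eq = trans (sym (strictlyInverseˡ x)) (I.inverseˡ eq)

  ¬∀⇒∃¬ : ∀ {p} {P : Pred A p} → P Respects _≈_ → U.Decidable P → ¬ (∀ x → P x) → ∃ λ x → ¬ P x
  ¬∀⇒∃¬ {P = P} resp P? ¬∀P = let i , ¬Pi = ¬∀⟶∃¬ N (P ∘ to) (P? ∘ to) ¬∀P∘to in to i , ¬Pi
    where
    ¬∀P∘to : ¬ (∀ i → P (to i))
    ¬∀P∘to ∀P = ¬∀P (λ x → resp (strictlyInverseˡ x) (∀P (from x)))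

  module _ (h : A → A) (h-cong : Congruent _≈_ _≈_ h) (h-injective : Injective _≈_ _≈_ h) where
    private
      σ : Fin N → Fin N
      σ = from ∘ h ∘ to

      σ-injective : Injective _≡_ _≡_ σ
      σ-injective = Bijection.injective enum ∘ h-injective ∘ from-injective

      τ : Fin N → Fin N
      τ j = proj₁ (Fin-injective⇒surjective σ σ-injective j)

      σ∘τ : ∀ j → σ (τ j) ≡ j
      σ∘τ j = proj₂ (Fin-injective⇒surjective σ σ-injective j)

      to∘σ : ∀ i → to (σ i) ≈ h (to i)
      to∘σ i = strictlyInverseˡ (h (to i))

    injective⇒bijective : Bijective _≈_ _≈_ h
    injective⇒bijective = h-injective , λ y → x y , λ z≈x → trans (h-cong z≈x) (hx≈y y)
      where
      x : A → A
      x y = to (τ (from y))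
      hx≈y : ∀ y → h (x y) ≈ y
      hx≈y y = trans (sym (to∘σ (τ (from y)))) (I.inverseˡ (σ∘τ (from y)))

    module _ {b ℓ′} (M : CommutativeMonoid b ℓ′) where
      open CommutativeMonoid M using () renaming (Carrier to B; _≈_ to _≈ᴹ_; trans to transᴹ)
      open import Algebra.Properties.CommutativeMonoid.Sum M using (sum; sum-permute; sum-cong-≋)

      sum-invariant : (F : A → B) → Congruent _≈_ _≈ᴹ_ F → sum (F ∘ to) ≈ᴹ sum (F ∘ h ∘ to)
      sum-invariant F F-cong = transᴹ (sum-permute (F ∘ to) π) (sum-cong-≋ (F-cong ∘ to∘σ))
        where
        π : Permutation N N
        π = permutation σ τ σ∘τ (λ i → σ-injective (σ∘τ (σ i)))

module _ {b ℓ} (M : CommutativeMonoid b ℓ) where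
  open CommutativeMonoid M
  open CommutativeMonoidSum M using (sum; sum-remove; sum-cong-≋; sum-replicate-zero)
  open import Relation.Binary.Reasoning.Setoid setoid

  sum-except-one : ∀ {n} (t : Fin n → Carrier) i → (∀ j → j ≢ i → t j ≈ ε) → sum t ≈ t i
  sum-except-one {suc n} t i t≈ε = begin
    sum t                        ≈⟨ sum-remove t ⟩
    t i ∙ sum (t ∘ punchIn i)    ≈⟨ ∙-congˡ (sum-cong-≋ (λ j → t≈ε _ (punchInᵢ≢i i j))) ⟩
    t i ∙ sum {n} (λ _ → ε)      ≈⟨ ∙-congˡ (sum-replicate-zero n) ⟩
    t i ∙ ε                      ≈⟨ identityʳ _ ⟩
    t i                          ∎

2+k<m : ∀ {m k} → k < m ∸ 2 → 2 ℕ.+ k < m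
2+k<m {suc (suc m)} k<m∸2 = ℕ.s≤s (ℕ.s≤s k<m∸2)

prime>1 : ∀ {p} → Prime p → 1 < p
prime>1 {p} p-prime = ℕ.nonTrivial⇒n>1 p {{prime⇒nonTrivial p-prime}}

prime∤factorial : ∀ {p m} → Prime p → m < p → p ∤ m !
prime∤factorial {m = zero}  p-prime _   p∣1 = <⇒≱ (prime>1 p-prime) (∣⇒≤ p∣1)
prime∤factorial {m = suc m} p-prime m<p p∣m! with euclidsLemma (suc m) (m !) p-prime p∣m!
... | inj₁ p∣1+m = <⇒≱ m<p (∣⇒≤ p∣1+m)
... | inj₂ p∣m!  = prime∤factorial p-prime (<-trans (n<1+n m) m<p) p∣m!

n∣n! : ∀ n → .{{ℕ.NonZero n}} → n ∣ n !
n∣n! (suc n) = m∣m*n (n !)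

nCk*k!*[n∸k]!≡n! : ∀ {n k} → k ℕ.≤ n → (n C k) ℕ.* (k ! ℕ.* (n ∸ k) !) ≡ n !
nCk*k!*[n∸k]!≡n! {n} {k} k≤n =
  ≡.trans (≡.cong (ℕ._* (k ! ℕ.* (n ∸ k) !)) (nCk≡n!/k![n-k]! k≤n)) (m/n*n≡m (k![n∸k]!∣n! k≤n))
  where
  instance
    k!*[n∸k]!≢0 : ℕ.NonZero (k ! ℕ.* (n ∸ k) !)
    k!*[n∸k]!≢0 = k !* (n ∸ k) !≢0

prime∣binomial : ∀ {p k} → Prime p → 0 < k → k < p → p ∣ p C k
prime∣binomial {p} {k} p-prime 0<k k<p
  with euclidsLemma (p C k) (k ! ℕ.* (p ∸ k) !) p-prime
         (≡.subst (p ∣_) (≡.sym (nCk*k!*[n∸k]!≡n! (<⇒≤ k<p))) (n∣n! p {{prime⇒nonZero p-prime}}))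
... | inj₁ p∣C = p∣C
... | inj₂ p∣k!*[p∸k]! with euclidsLemma (k !) ((p ∸ k) !) p-prime p∣k!*[p∸k]!
...   | inj₁ p∣k!     = contradiction p∣k! (prime∤factorial p-prime k<p)
...   | inj₂ p∣[p∸k]! = contradiction p∣[p∸k]! (prime∤factorial p-prime (∸-monoʳ-< 0<k (<⇒≤ k<p)))

module RingProperties {c ℓ} (K : CommutativeRing c ℓ) where
  open CommutativeRing K hiding (zero)
  open import Algebra.Properties.Semiring.Exp semiring
  open import Algebra.Properties.Semiring.Mult semiring using (×1-homo-*; ×-congˡ; ×-congʳ; ×-assocˡ; ×-assoc-*) renaming (_×_ to _×ₘ_)
  open import Algebra.Properties.Monoid.Sum +-monoid using (sum; sum-cong-≋; sum-replicate-zero; sum-init-last)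
  open import Algebra.Properties.CommutativeSemiring.Binomial commutativeSemiring using (theorem; binomialTerm)
  open import Algebra.Properties.CommutativeSemiring.Exp commutativeSemiring using (^-distrib-*)
  open import Algebra.Solver.Ring.NaturalCoefficients commutativeSemiring (λ _ _ → nothing)
  open import Relation.Binary.Reasoning.Setoid setoid

  ×1-^ : ∀ m j → (m ℕ.^ j) ×ₘ 1# ≈ (m ×ₘ 1#) ^ j
  ×1-^ m zero    = +-identityʳ 1#
  ×1-^ m (suc j) = trans (×1-homo-* m (m ℕ.^ j)) (*-congˡ (×1-^ m j))

  1^n≈1 : ∀ n → 1# ^ n ≈ 1#
  1^n≈1 zero    = refl
  1^n≈1 (suc n) = trans (*-identityˡ _) (1^n≈1 n)

  freshman's-dream : ∀ {n} .{{_ : ℕ.NonZero n}} →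
                     (∀ {k} → 0 < k → k < n → ∀ z → (n C k) ×ₘ z ≈ 0#) →
                     ∀ x y → (x + y) ^ n ≈ x ^ n + y ^ n
  freshman's-dream {suc n} middle≈0 x y = begin
    (x + y) ^ suc n                                 ≈⟨ theorem (suc n) x y ⟩
    t zero + sum (t∘suc)                            ≈⟨ +-congˡ (sum-init-last (t∘suc)) ⟩
    t zero + (sum (λ i → t (suc (inject₁ i))) + t (suc (fromℕ n)))
      ≈⟨ +-cong bottom (+-cong (trans (sum-cong-≋ inner) (sum-replicate-zero n)) top) ⟩
    y ^ suc n + (0# + x ^ suc n)                    ≈⟨ trans (+-congˡ (+-identityˡ _)) (+-comm _ _) ⟩
    x ^ suc n + y ^ suc n                           ∎
    where
    t : Fin (suc (suc n)) → Carrier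
    t = binomialTerm x y (suc n)
    t∘suc : Fin (suc n) → Carrier
    t∘suc i = t (suc i)
    bottom : t zero ≈ y ^ suc n
    bottom = trans (+-identityʳ _) (*-identityˡ _)
    top : t (suc (fromℕ n)) ≈ x ^ suc n
    top rewrite toℕ-fromℕ n | nCn≡1 (suc n) | n∸n≡0 n = trans (+-identityʳ _) (*-identityʳ _)
    inner : ∀ i → t (suc (inject₁ i)) ≈ 0#
    inner i = middle≈0 (ℕ.s≤s ℕ.z≤n) (ℕ.s≤s (≡.subst (_< n) (≡.sym (toℕ-inject₁ i)) (toℕ<n i))) _

  sumN-cong : ∀ n {f g : ℕ → Carrier} → (∀ k → k < n → f k ≈ g k) → sumN K n f ≈ sumN K n g
  sumN-cong zero    f≈g = refl
  sumN-cong (suc n) f≈g = +-cong (sumN-cong n (λ k k<n → f≈g k (ℕₚ.m<n⇒m<1+n k<n))) (f≈g n (ℕₚ.n<1+n n))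

  sumN-distribʳ : ∀ n (f : ℕ → Carrier) x → sumN K n f * x ≈ sumN K n (λ k → f k * x)
  sumN-distribʳ zero    f x = zeroˡ x
  sumN-distribʳ (suc n) f x = trans (distribʳ x _ _) (+-congʳ (sumN-distribʳ n f x))

  sumN-closed : ∀ {p} (P : Carrier → Set p) → (∀ {x y} → P x → P y → P (x + y)) → P 0# →
                ∀ n (f : ℕ → Carrier) → (∀ k → k < n → P (f k)) → P (sumN K n f)
  sumN-closed P P-+ P-0 zero    f Pf = P-0
  sumN-closed P P-+ P-0 (suc n) f Pf =
    P-+ (sumN-closed P P-+ P-0 n f (λ k k<n → Pf k (ℕₚ.m<n⇒m<1+n k<n))) (Pf n (ℕₚ.n<1+n n))

  gPoly-cong : ∀ q m a λ₀ {y z} → y ≈ z → gPoly K q m a λ₀ y ≈ gPoly K q m a λ₀ z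
  gPoly-cong q m a λ₀ y≈z =
    +-cong (^-congˡ m y≈z) (sumN-cong (m ∸ 2) (λ k _ → *-congˡ (*-congˡ (^-congˡ (2 ℕ.+ k) y≈z))))

  gPoly-dehomogenised : ℕ → (ℕ → Carrier) → Carrier → Carrier
  gPoly-dehomogenised m a t = t ^ m + sumN K (m ∸ 2) (λ k → a (2 ℕ.+ k) * t ^ (2 ℕ.+ k))

  gPoly-homogeneous : ∀ q m a λ₀ t → gPoly K q m a λ₀ (t * λ₀) ≈ gPoly-dehomogenised m a t * λ₀ ^ m
  gPoly-homogeneous q m a λ₀ t = begin
    (t * λ₀) ^ m + sumN K (m ∸ 2) (λ k → λ₀ ^ (m ∸ (2 ℕ.+ k)) * (a (2 ℕ.+ k) * (t * λ₀) ^ (2 ℕ.+ k)))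
      ≈⟨ +-cong (^-distrib-* t λ₀ m) (sumN-cong (m ∸ 2) term) ⟩
    t ^ m * λ₀ ^ m + sumN K (m ∸ 2) (λ k → (a (2 ℕ.+ k) * t ^ (2 ℕ.+ k)) * λ₀ ^ m)
      ≈⟨ +-congˡ (sumN-distribʳ (m ∸ 2) _ (λ₀ ^ m)) ⟨
    t ^ m * λ₀ ^ m + sumN K (m ∸ 2) (λ k → a (2 ℕ.+ k) * t ^ (2 ℕ.+ k)) * λ₀ ^ m
      ≈⟨ distribʳ (λ₀ ^ m) _ _ ⟨
    gPoly-dehomogenised m a t * λ₀ ^ m ∎
    where
    term : ∀ k → k < m ∸ 2 →
           λ₀ ^ (m ∸ (2 ℕ.+ k)) * (a (2 ℕ.+ k) * (t * λ₀) ^ (2 ℕ.+ k)) ≈ (a (2 ℕ.+ k) * t ^ (2 ℕ.+ k)) * λ₀ ^ m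
    term k k<m∸2 = begin
      λ₀ ^ (m ∸ i) * (a i * (t * λ₀) ^ i)      ≈⟨ *-congˡ (*-congˡ (^-distrib-* t λ₀ i)) ⟩
      λ₀ ^ (m ∸ i) * (a i * (t ^ i * λ₀ ^ i))  ≈⟨ solve 4 (λ R A T L → R :* (A :* (T :* L)) := (A :* T) :* (L :* R))
                                                       refl (λ₀ ^ (m ∸ i)) (a i) (t ^ i) (λ₀ ^ i) ⟩
      (a i * t ^ i) * (λ₀ ^ i * λ₀ ^ (m ∸ i))  ≈⟨ *-congˡ (^-homo-* λ₀ i (m ∸ i)) ⟨
      (a i * t ^ i) * λ₀ ^ (i ℕ.+ (m ∸ i))     ≈⟨ *-congˡ (^-congʳ λ₀ (ℕₚ.m+[n∸m]≡n (ℕₚ.<⇒≤ (2+k<m {m} k<m∸2)))) ⟩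
      (a i * t ^ i) * λ₀ ^ m                   ∎
      where
      i : ℕ
      i = 2 ℕ.+ k

  +-transpose : ∀ {a x b y} → a + x ≈ b + y → x ≈ y + (b - a)
  +-transpose {a} {x} {b} {y} eq = begin
    x                   ≈⟨ +-identityʳ x ⟨
    x + 0#              ≈⟨ +-congˡ (-‿inverseʳ a) ⟨
    x + (a - a)         ≈⟨ solve 3 (λ a x na → x :+ (a :+ na) := (a :+ x) :+ na) refl a x (- a) ⟩
    (a + x) - a         ≈⟨ +-congʳ eq ⟩
    (b + y) - a         ≈⟨ solve 3 (λ b y na → (b :+ y) :+ na := y :+ (b :+ na)) refl b y (- a) ⟩
    y + (b - a)         ∎

  module _ {p} (p-prime : Prime p) (char-p : p ×ₘ 1# ≈ 0#) where

    ×-vanishes : ∀ {n} → p ∣ n → ∀ z → n ×ₘ z ≈ 0#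
    ×-vanishes {n} (divides d n≡d*p) z = begin
      n ×ₘ z          ≈⟨ ×-congˡ n≡d*p ⟩
      (d ℕ.* p) ×ₘ z  ≈⟨ ×-assocˡ z d p ⟨
      d ×ₘ (p ×ₘ z)   ≈⟨ ×-congʳ d p×z≈0 ⟩
      d ×ₘ 0#         ≈⟨ ×-zero d ⟩
      0#              ∎
      where
      p×z≈0 : p ×ₘ z ≈ 0#
      p×z≈0 = begin
        p ×ₘ z         ≈⟨ ×-congʳ p (*-identityˡ z) ⟨
        p ×ₘ (1# * z)  ≈⟨ ×-assoc-* p 1# z ⟨
        (p ×ₘ 1#) * z  ≈⟨ *-congʳ char-p ⟩
        0# * z         ≈⟨ zeroˡ z ⟩
        0#             ∎
      ×-zero : ∀ d → d ×ₘ 0# ≈ 0#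
      ×-zero zero    = refl
      ×-zero (suc d) = trans (+-identityˡ _) (×-zero d)

    ^p^j-+ : ∀ j x y → (x + y) ^ (p ℕ.^ j) ≈ x ^ (p ℕ.^ j) + y ^ (p ℕ.^ j)
    ^p^j-+ zero    x y = trans (*-identityʳ _) (sym (+-cong (*-identityʳ x) (*-identityʳ y)))
    ^p^j-+ (suc j) x y = begin
      (x + y) ^ (p ℕ.* p ℕ.^ j)             ≈⟨ sym (^-assocʳ (x + y) p (p ℕ.^ j)) ⟩
      ((x + y) ^ p) ^ (p ℕ.^ j)             ≈⟨ ^-congˡ (p ℕ.^ j) (^p-+ x y) ⟩
      (x ^ p + y ^ p) ^ (p ℕ.^ j)           ≈⟨ ^p^j-+ j (x ^ p) (y ^ p) ⟩
      (x ^ p) ^ (p ℕ.^ j) + (y ^ p) ^ (p ℕ.^ j) ≈⟨ +-cong (^-assocʳ x p (p ℕ.^ j)) (^-assocʳ y p (p ℕ.^ j)) ⟩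
      x ^ (p ℕ.* p ℕ.^ j) + y ^ (p ℕ.* p ℕ.^ j) ∎
      where
      instance
        p≢0 : ℕ.NonZero p
        p≢0 = prime⇒nonZero p-prime
      ^p-+ : ∀ x y → (x + y) ^ p ≈ x ^ p + y ^ p
      ^p-+ = freshman's-dream (λ 0<k k<p → ×-vanishes (prime∣binomial p-prime 0<k k<p))

module FieldProperties {c ℓ} (K : CommutativeRing c ℓ) (F : IsField K) where
  open CommutativeRing K hiding (zero)
  open IsField F
  private module Π = CommutativeMonoidSum *-commutativeMonoid
  open import Algebra.Properties.Semiring.Exp semiring
  open import Algebra.Properties.Ring ring using (-‿involutive; -0#≈0#)
  open import Relation.Binary.Reasoning.Setoid setoid

  1≉0 : 1# ≉ 0#
  1≉0 = 0≉1 ∘ sym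

  -1≉0 : - 1# ≉ 0#
  -1≉0 -1≈0 = 1≉0 (trans (sym (-‿involutive 1#)) (trans (-‿cong -1≈0) -0#≈0#))

  inv : ∀ x → x ≉ 0# → Carrier
  inv x x≉0 = proj₁ (inverse x x≉0)

  inv-inverseʳ : ∀ {x} (x≉0 : x ≉ 0#) → x * inv x x≉0 ≈ 1#
  inv-inverseʳ {x} x≉0 = proj₂ (inverse x x≉0)

  inv-inverseˡ : ∀ {x} (x≉0 : x ≉ 0#) → inv x x≉0 * x ≈ 1#
  inv-inverseˡ x≉0 = trans (*-comm _ _) (inv-inverseʳ x≉0)

  *-cancelˡ : ∀ {a x y} → a ≉ 0# → a * x ≈ a * y → x ≈ y
  *-cancelˡ {a} {x} {y} a≉0 ax≈ay = begin
    x                  ≈⟨ *-identityˡ x ⟨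
    1# * x             ≈⟨ *-congʳ (inv-inverseˡ a≉0) ⟨
    (inv a a≉0 * a) * x ≈⟨ *-assoc _ a x ⟩
    inv a a≉0 * (a * x) ≈⟨ *-congˡ ax≈ay ⟩
    inv a a≉0 * (a * y) ≈⟨ *-assoc _ a y ⟨
    (inv a a≉0 * a) * y ≈⟨ *-congʳ (inv-inverseˡ a≉0) ⟩
    1# * y             ≈⟨ *-identityˡ y ⟩
    y                  ∎

  *-cancelʳ : ∀ {a x y} → a ≉ 0# → x * a ≈ y * a → x ≈ y
  *-cancelʳ a≉0 xa≈ya = *-cancelˡ a≉0 (trans (*-comm _ _) (trans xa≈ya (*-comm _ _)))

  *-nonzero : ∀ {x y} → x ≉ 0# → y ≉ 0# → x * y ≉ 0#
  *-nonzero {x} x≉0 y≉0 xy≈0 = y≉0 (*-cancelˡ x≉0 (trans xy≈0 (sym (zeroʳ x))))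

  ^-nonzero : ∀ {x} n → x ≉ 0# → x ^ n ≉ 0#
  ^-nonzero zero    x≉0 = 1≉0
  ^-nonzero (suc n) x≉0 = *-nonzero x≉0 (^-nonzero n x≉0)

  Π-nonzero : ∀ {n} (t : Fin n → Carrier) → (∀ i → t i ≉ 0#) → Π.sum t ≉ 0#
  Π-nonzero {zero}  t t≉0 = 1≉0
  Π-nonzero {suc n} t t≉0 = *-nonzero (t≉0 _) (Π-nonzero (t ∘ Fin.suc) (t≉0 ∘ Fin.suc))

  module _ (_≟_ : Decidable _≈_) where

    ^≈0⇒≈0 : ∀ {x} n → x ^ n ≈ 0# → x ≈ 0#
    ^≈0⇒≈0 {x} n xⁿ≈0 with x ≟ 0#
    ... | yes x≈0 = x≈0
    ... | no  x≉0 = contradiction xⁿ≈0 (^-nonzero n x≉0)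

module FiniteField {c ℓ} (K : CommutativeRing c ℓ) (F : IsField K)
                   {N : ℕ} (enum : Bijection (≡.setoid (Fin N)) (CommutativeRing.setoid K)) where
  open CommutativeRing K hiding (zero)
  open FieldProperties K F
  open FiniteSetoid setoid enum public
  open Bijection enum using (to)
  open import Algebra.Properties.Semiring.Exp semiring
  open import Algebra.Properties.Semiring.Mult semiring using (×-congˡ) renaming (_×_ to _×ₘ_)
  open import Algebra.Properties.Group +-group using (identityʳ-unique; ∙-cancelʳ)
  open import Relation.Binary.Reasoning.Setoid setoid
  private
    module Σ = CommutativeMonoidSum +-commutativeMonoid
    module Π = CommutativeMonoidSum *-commutativeMonoid

  card×1≈0 : N ×ₘ 1# ≈ 0#
  card×1≈0 = identityʳ-unique (Σ.sum to) (N ×ₘ 1#) (sym (begin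
    Σ.sum to                           ≈⟨ sum-invariant (_+ 1#) +-congʳ (∙-cancelʳ 1# _ _) +-commutativeMonoid id id ⟩
    Σ.sum (λ i → to i + 1#)            ≈⟨ Σ.∑-distrib-+ {N} to (λ _ → 1#) ⟩
    Σ.sum to + Σ.sum {N} (λ _ → 1#)    ≈⟨ +-congˡ (Σ.sum-replicate N) ⟩
    Σ.sum to + N ×ₘ 1#                 ∎))

  prime-power-card⇒char : ∀ {p j} → N ≡ p ℕ.^ j → p ×ₘ 1# ≈ 0#
  prime-power-card⇒char {p} {j} N≡pʲ = ^≈0⇒≈0 _≟_ j (begin
    (p ×ₘ 1#) ^ j    ≈⟨ RingProperties.×1-^ K p j ⟨
    (p ℕ.^ j) ×ₘ 1#  ≈⟨ ×-congˡ (≡.sym N≡pʲ) ⟩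
    N ×ₘ 1#          ≈⟨ card×1≈0 ⟩
    0#               ∎)

  -- Fermat: x ↦ a x permutes K, so U = ∏ₓ nonzeroPart x equals ∏ₓ nonzeroPart (a x), and
  -- nonzeroPart (a x) = a · nonzeroPart x except at x = 0, which zeroCorrection repairs; hence a U = aᴺ U.
  module _ {a} (a≉0 : a ≉ 0#) where
    nonzeroPart : Carrier → Carrier
    nonzeroPart x with x ≟ 0#
    ... | yes _ = 1#
    ... | no  _ = x

    zeroCorrection : Carrier → Carrier
    zeroCorrection x with x ≟ 0#
    ... | yes _ = a
    ... | no  _ = 1#

    nonzeroPart-cong : ∀ {x y} → x ≈ y → nonzeroPart x ≈ nonzeroPart y
    nonzeroPart-cong {x} {y} x≈y with x ≟ 0# | y ≟ 0#
    ... | yes _   | yes _   = refl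
    ... | yes x≈0 | no  y≉0 = contradiction (trans (sym x≈y) x≈0) y≉0
    ... | no  x≉0 | yes y≈0 = contradiction (trans x≈y y≈0) x≉0
    ... | no  _   | no  _   = x≈y

    nonzeroPart-nonzero : ∀ x → nonzeroPart x ≉ 0#
    nonzeroPart-nonzero x with x ≟ 0#
    ... | yes _   = 1≉0
    ... | no  x≉0 = x≉0

    nonzeroPart-* : ∀ x → nonzeroPart (a * x) * zeroCorrection x ≈ a * nonzeroPart x
    nonzeroPart-* x with x ≟ 0# | a * x ≟ 0#
    ... | yes _   | yes _    = trans (*-identityˡ a) (sym (*-identityʳ a))
    ... | yes x≈0 | no  ax≉0 = contradiction (trans (*-congˡ x≈0) (zeroʳ a)) ax≉0
    ... | no  x≉0 | yes ax≈0 = contradiction ax≈0 (*-nonzero a≉0 x≉0)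
    ... | no  _   | no  _    = *-identityʳ _

    Π-zeroCorrection : Π.sum (zeroCorrection ∘ to) ≈ a
    Π-zeroCorrection = trans (sum-except-one *-commutativeMonoid (zeroCorrection ∘ to) (from 0#) away-from-0) at-0
      where
      at-0 : zeroCorrection (to (from 0#)) ≈ a
      at-0 with to (from 0#) ≟ 0#
      ... | yes _  = refl
      ... | no ≉0 = contradiction (strictlyInverseˡ 0#) ≉0
      away-from-0 : ∀ j → j ≢ from 0# → zeroCorrection (to j) ≈ 1#
      away-from-0 j j≢from0 with to j ≟ 0#
      ... | yes toj≈0 = contradiction (Bijection.injective enum (trans toj≈0 (sym (strictlyInverseˡ 0#)))) j≢from0
      ... | no  _     = refl

    fermat-nonzero : a ^ N ≈ a
    fermat-nonzero = *-cancelʳ (Π-nonzero (nonzeroPart ∘ to) (nonzeroPart-nonzero ∘ to)) (begin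
      a ^ N * U                                               ≈⟨ *-congʳ (Π.sum-replicate N) ⟨
      Π.sum {N} (λ _ → a) * U                                 ≈⟨ Π.∑-distrib-+ (λ _ → a) (nonzeroPart ∘ to) ⟨
      Π.sum (λ i → a * nonzeroPart (to i))                    ≈⟨ Π.sum-cong-≋ (nonzeroPart-* ∘ to) ⟨
      Π.sum (λ i → nonzeroPart (a * to i) * zeroCorrection (to i))
                                                              ≈⟨ Π.∑-distrib-+ (nonzeroPart ∘ (a *_) ∘ to) (zeroCorrection ∘ to) ⟩
      Π.sum (nonzeroPart ∘ (a *_) ∘ to) * Π.sum (zeroCorrection ∘ to)
        ≈⟨ *-cong (sym (sum-invariant (a *_) *-congˡ (*-cancelˡ a≉0) *-commutativeMonoid nonzeroPart nonzeroPart-cong))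
                  Π-zeroCorrection ⟩
      U * a                                                   ≈⟨ *-comm U a ⟩
      a * U                                                   ∎)
      where
      U : Carrier
      U = Π.sum (nonzeroPart ∘ to)

  fermat : ∀ x → x ^ N ≈ x
  fermat x with x ≟ 0#
  ... | no  x≉0 = fermat-nonzero x≉0
  ... | yes x≈0 = trans (^-congˡ N x≈0) (trans (0ⁿ≈0 (from 0#)) (sym x≈0))
    where
    0ⁿ≈0 : ∀ {n} → Fin n → 0# ^ n ≈ 0#
    0ⁿ≈0 {suc n} _ = zeroˡ _

module LinearizedPolynomials {c ℓ} (K : CommutativeRing c ℓ) (F : IsField K) (q : ℕ) where
  open CommutativeRing K hiding (zero)
  open FieldProperties K F
  open RingProperties K using (1^n≈1)
  open import Algebra.Properties.Semiring.Exp semiring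
  open import Algebra.Properties.CommutativeSemiring.Exp commutativeSemiring using (^-distrib-*)
  open import Algebra.Properties.Ring ring
    using (+-identityʳ-unique; +-inverseˡ-unique; -‿distribˡ-*; -‿distribʳ-*; -1*x≈-x; -‿involutive; x∙y⁻¹≈ε⇒x≈y; x≈y⇒x∙y⁻¹≈ε)
  open import Algebra.Solver.Ring.NaturalCoefficients commutativeSemiring (λ _ _ → nothing)
  open import Relation.Binary.Reasoning.Setoid setoid

  private
    Fq : Carrier → Set ℓ
    Fq = InFq K q

  InFq-1 : Fq 1#
  InFq-1 = 1^n≈1 q

  InFq-* : ∀ {x y} → Fq x → Fq y → Fq (x * y)
  InFq-* xᵠ≈x yᵠ≈y = trans (^-distrib-* _ _ q) (*-cong xᵠ≈x yᵠ≈y)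

  InFq-^ : ∀ {x} n → Fq x → Fq (x ^ n)
  InFq-^ {x} n xᵠ≈x = begin
    (x ^ n) ^ q   ≈⟨ ^-assocʳ x n q ⟩
    x ^ (n ℕ.* q) ≈⟨ ^-congʳ x (ℕₚ.*-comm n q) ⟩
    x ^ (q ℕ.* n) ≈⟨ ^-assocʳ x q n ⟨
    (x ^ q) ^ n   ≈⟨ ^-congˡ n xᵠ≈x ⟩
    x ^ n         ∎

  InFq-inv : ∀ {x} (x≉0 : x ≉ 0#) → Fq x → Fq (inv x x≉0)
  InFq-inv {x} x≉0 xᵠ≈x = *-cancelʳ x≉0 (begin
    inv x x≉0 ^ q * x      ≈⟨ *-congˡ xᵠ≈x ⟨
    inv x x≉0 ^ q * x ^ q  ≈⟨ ^-distrib-* _ x q ⟨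
    (inv x x≉0 * x) ^ q    ≈⟨ ^-congˡ q (inv-inverseˡ x≉0) ⟩
    1# ^ q                 ≈⟨ InFq-1 ⟩
    1#                     ≈⟨ inv-inverseˡ x≉0 ⟨
    inv x x≉0 * x          ∎)

  eigen-ratio-InFq : ∀ {a b v w} → a ≉ 0# → (v≉0 : v ≉ 0#) →
                     a * v ^ q ≈ b * v → a * w ^ q ≈ b * w → Fq (w * inv v v≉0)
  eigen-ratio-InFq {a} {b} {v} {w} a≉0 v≉0 eq-v eq-w = *-cancelʳ (*-nonzero a≉0 (^-nonzero q v≉0)) (begin
    r ^ q * (a * v ^ q)  ≈⟨ solve 3 (λ R A V → R :* (A :* V) := A :* (R :* V)) refl (r ^ q) a (v ^ q) ⟩
    a * (r ^ q * v ^ q)  ≈⟨ *-congˡ (^-distrib-* r v q) ⟨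
    a * (r * v) ^ q      ≈⟨ *-congˡ (^-congˡ q r*v≈w) ⟩
    a * w ^ q            ≈⟨ eq-w ⟩
    b * w                ≈⟨ *-congˡ r*v≈w ⟨
    b * (r * v)          ≈⟨ solve 3 (λ B R V → B :* (R :* V) := R :* (B :* V)) refl b r v ⟩
    r * (b * v)          ≈⟨ *-congˡ eq-v ⟨
    r * (a * v ^ q)      ∎)
    where
    r : Carrier
    r = w * inv v v≉0
    r*v≈w : r * v ≈ w
    r*v≈w = trans (*-assoc w _ v) (trans (*-congˡ (inv-inverseˡ v≉0)) (*-identityʳ w))

  module _ (^q-+ : ∀ x y → (x + y) ^ q ≈ x ^ q + y ^ q) where

    0^q≈0 : 0# ^ q ≈ 0#
    0^q≈0 = +-identityʳ-unique (0# ^ q) (0# ^ q)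
      (sym (trans (^-congˡ q (sym (+-identityʳ 0#))) (^q-+ 0# 0#)))

    ^q-‿ : ∀ x → (- x) ^ q ≈ - (x ^ q)
    ^q-‿ x = +-inverseˡ-unique _ _ (trans (sym (^q-+ (- x) x)) (trans (^-congˡ q (-‿inverseˡ x)) 0^q≈0))

    InFq-0 : Fq 0#
    InFq-0 = 0^q≈0

    InFq-+ : ∀ {x y} → Fq x → Fq y → Fq (x + y)
    InFq-+ xᵠ≈x yᵠ≈y = trans (^q-+ _ _) (+-cong xᵠ≈x yᵠ≈y)

    InFq-‿ : ∀ {x} → Fq x → Fq (- x)
    InFq-‿ xᵠ≈x = trans (^q-‿ _) (-‿cong xᵠ≈x)

    module _ (α₁ α₀ : Carrier) where
      private
        L : Carrier → Carrier
        L = linearized K q α₁ α₀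

      linearized-cong : ∀ {x y} → x ≈ y → L x ≈ L y
      linearized-cong x≈y = +-cong (*-congˡ (^-congˡ q x≈y)) (*-congˡ x≈y)

      linearized-0 : L 0# ≈ 0#
      linearized-0 = trans (+-cong (trans (*-congˡ 0^q≈0) (zeroʳ α₁)) (zeroʳ α₀)) (+-identityʳ 0#)

      linearized-+ : ∀ x y → L (x + y) ≈ L x + L y
      linearized-+ x y = begin
        α₁ * (x + y) ^ q + α₀ * (x + y)       ≈⟨ +-congʳ (*-congˡ (^q-+ x y)) ⟩
        α₁ * (x ^ q + y ^ q) + α₀ * (x + y)   ≈⟨ solve 6 (λ a b x y X Y → a :* (X :+ Y) :+ b :* (x :+ y) := (a :* X :+ b :* x) :+ (a :* Y :+ b :* y))
                                                      refl α₁ α₀ x y (x ^ q) (y ^ q) ⟩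
        L x + L y                              ∎

      linearized-* : ∀ {e} x → Fq e → L (e * x) ≈ e * L x
      linearized-* {e} x eᵠ≈e = begin
        α₁ * (e * x) ^ q + α₀ * (e * x)    ≈⟨ +-congʳ (*-congˡ (trans (^-distrib-* e x q) (*-congʳ eᵠ≈e))) ⟩
        α₁ * (e * x ^ q) + α₀ * (e * x)    ≈⟨ solve 5 (λ a b e x X → a :* (e :* X) :+ b :* (e :* x) := e :* (a :* X :+ b :* x))
                                                   refl α₁ α₀ e x (x ^ q) ⟩
        e * L x                             ∎

      linearized-‿ : ∀ x → L (- x) ≈ - L x
      linearized-‿ x = trans (linearized-cong (sym (-1*x≈-x x)))
                             (trans (linearized-* x (InFq-‿ InFq-1)) (-1*x≈-x (L x)))

    module Rank2 {α₁ α₀ : Carrier} (rank : HasRank K q (linearized K q α₁ α₀) 2) where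
      v : Fin 2 → Carrier
      v = proj₁ rank

      private
        pair : Carrier → Carrier → Fin 2 → Carrier
        pair x y zero       = x
        pair x y (suc zero) = y

        pair-InFq : ∀ {x y} → Fq x → Fq y → ∀ i → Fq (pair x y i)
        pair-InFq xᵠ≈x yᵠ≈y zero       = xᵠ≈x
        pair-InFq xᵠ≈x yᵠ≈y (suc zero) = yᵠ≈y

      v₀ v₁ : Carrier
      v₀ = v zero
      v₁ = v (suc zero)

      private
        combo-pair : ∀ x y → combo K q (pair x y) v ≈ x * v₀ + y * v₁
        combo-pair x y = +-congˡ (+-identityʳ _)

      independent : ∀ {x y} → Fq x → Fq y → x * v₀ + y * v₁ ≈ 0# → x ≈ 0# × y ≈ 0#
      independent {x} {y} xᵠ≈x yᵠ≈y combo≈0 = is-zero zero , is-zero (suc zero)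
        where
        is-zero : ∀ i → pair x y i ≈ 0#
        is-zero = proj₁ (proj₂ rank) (pair _ _) (pair-InFq xᵠ≈x yᵠ≈y) (trans (combo-pair _ _) combo≈0)

      private
        in-image : ∀ {x y} → Fq x → Fq y → ∃ λ z → linearized K q α₁ α₀ z ≈ x * v₀ + y * v₁
        in-image {x} {y} xᵠ≈x yᵠ≈y =
          proj₂ (proj₂ (proj₂ rank) _) (pair x y , pair-InFq xᵠ≈x yᵠ≈y , sym (combo-pair x y))

      basis-in-image : ∀ i → ∃ λ z → linearized K q α₁ α₀ z ≈ v i
      basis-in-image zero with z , Lz≈ ← in-image InFq-1 InFq-0 =
        z , trans Lz≈ (trans (+-cong (*-identityˡ v₀) (zeroˡ v₁)) (+-identityʳ v₀))
      basis-in-image (suc zero) with z , Lz≈ ← in-image InFq-0 InFq-1 =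
        z , trans Lz≈ (trans (+-cong (zeroˡ v₀) (*-identityˡ v₁)) (+-identityˡ v₁))

      v₀≉0 : v₀ ≉ 0#
      v₀≉0 v₀≈0 = 1≉0 (proj₁ (independent InFq-1 InFq-0 (begin
        1# * v₀ + 0# * v₁  ≈⟨ +-cong (trans (*-congˡ v₀≈0) (zeroʳ 1#)) (zeroˡ v₁) ⟩
        0# + 0#            ≈⟨ +-identityʳ 0# ⟩
        0#                 ∎)))

      basis-ratio-∉Fq : ¬ Fq (v₁ * inv v₀ v₀≉0)
      basis-ratio-∉Fq ratioᵠ≈ratio = -1≉0 (proj₂ (independent ratioᵠ≈ratio (InFq-‿ InFq-1) (begin
        v₁ * inv v₀ v₀≉0 * v₀ + - 1# * v₁  ≈⟨ +-cong (trans (*-assoc _ _ _) (trans (*-congˡ (inv-inverseˡ v₀≉0)) (*-identityʳ v₁)))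
                                                     (-1*x≈-x v₁) ⟩
        v₁ + - v₁                          ≈⟨ -‿inverseʳ v₁ ⟩
        0#                                 ∎)))

      ¬all-InFq : ¬ (∀ u → Fq u)
      ¬all-InFq all-InFq = basis-ratio-∉Fq (all-InFq _)

    module _ (δ : Carrier) where
      private
        s : Carrier → Carrier
        s = sPoly K q δ

        s≈L : ∀ x → s x ≈ linearized K q 1# δ x
        s≈L x = +-congʳ (sym (*-identityˡ _))

      sPoly-cong : ∀ {x y} → x ≈ y → s x ≈ s y
      sPoly-cong x≈y = trans (s≈L _) (trans (linearized-cong 1# δ x≈y) (sym (s≈L _)))

      sPoly-+ : ∀ x y → s (x + y) ≈ s x + s y
      sPoly-+ x y = trans (s≈L _) (trans (linearized-+ 1# δ x y) (sym (+-cong (s≈L x) (s≈L y))))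

      sPoly-* : ∀ {e} x → Fq e → s (e * x) ≈ e * s x
      sPoly-* x eᵠ≈e = trans (s≈L _) (trans (linearized-* 1# δ x eᵠ≈e) (*-congˡ (sym (s≈L x))))

    module _ (^q-^q : ∀ x → (x ^ q) ^ q ≈ x) {α₁ α₀ : Carrier} where
      private
        L : Carrier → Carrier
        L = linearized K q α₁ α₀

      kernel-nontrivial⇒norms-equal : ∀ {x} → x ≉ 0# → L x ≈ 0# → α₁ * α₁ ^ q ≈ α₀ * α₀ ^ q
      kernel-nontrivial⇒norms-equal {x} x≉0 Lx≈0 = *-cancelʳ x≉0 (begin
        (α₁ * α₁ ^ q) * x           ≈⟨ solve 3 (λ a A x → (a :* A) :* x := a :* (A :* x)) refl α₁ (α₁ ^ q) x ⟩
        α₁ * (α₁ ^ q * x)           ≈⟨ *-congˡ conjugate ⟩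
        α₁ * - (α₀ ^ q * x ^ q)     ≈⟨ -‿distribʳ-* _ _ ⟨
        - (α₁ * (α₀ ^ q * x ^ q))   ≈⟨ -‿cong (solve 3 (λ a B X → a :* (B :* X) := B :* (a :* X)) refl α₁ (α₀ ^ q) (x ^ q)) ⟩
        - (α₀ ^ q * (α₁ * x ^ q))   ≈⟨ -‿cong (*-congˡ α₁xᵠ≈-α₀x) ⟩
        - (α₀ ^ q * - (α₀ * x))     ≈⟨ -‿cong (-‿distribʳ-* _ _) ⟨
        - - (α₀ ^ q * (α₀ * x))     ≈⟨ -‿involutive _ ⟩
        α₀ ^ q * (α₀ * x)           ≈⟨ solve 3 (λ B b x → B :* (b :* x) := (b :* B) :* x) refl (α₀ ^ q) α₀ x ⟩
        (α₀ * α₀ ^ q) * x           ∎)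
        where
        α₁xᵠ≈-α₀x : α₁ * x ^ q ≈ - (α₀ * x)
        α₁xᵠ≈-α₀x = +-inverseˡ-unique _ _ Lx≈0
        conjugate : α₁ ^ q * x ≈ - (α₀ ^ q * x ^ q)
        conjugate = begin
          α₁ ^ q * x             ≈⟨ *-congˡ (^q-^q x) ⟨
          α₁ ^ q * (x ^ q) ^ q   ≈⟨ ^-distrib-* α₁ (x ^ q) q ⟨
          (α₁ * x ^ q) ^ q       ≈⟨ ^-congˡ q α₁xᵠ≈-α₀x ⟩
          (- (α₀ * x)) ^ q       ≈⟨ ^q-‿ _ ⟩
          - ((α₀ * x) ^ q)       ≈⟨ -‿cong (^-distrib-* α₀ x q) ⟩
          - (α₀ ^ q * x ^ q)     ∎

      norms-equal⇒image-eigen : α₁ * α₁ ^ q ≈ α₀ * α₀ ^ q → ∀ x → α₁ * L x ^ q ≈ α₀ ^ q * L x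
      norms-equal⇒image-eigen norms x = begin
        α₁ * (α₁ * x ^ q + α₀ * x) ^ q              ≈⟨ *-congˡ (^q-+ _ _) ⟩
        α₁ * ((α₁ * x ^ q) ^ q + (α₀ * x) ^ q)      ≈⟨ *-congˡ (+-cong (trans (^-distrib-* _ _ q) (*-congˡ (^q-^q x))) (^-distrib-* _ _ q)) ⟩
        α₁ * (α₁ ^ q * x + α₀ ^ q * x ^ q)          ≈⟨ solve 5 (λ a A b B X → a :* (A :* X :+ B :* b) := (a :* A) :* X :+ B :* (a :* b))
                                                          refl α₁ (α₁ ^ q) (x ^ q) (α₀ ^ q) x ⟩
        (α₁ * α₁ ^ q) * x + α₀ ^ q * (α₁ * x ^ q)   ≈⟨ +-congʳ (*-congʳ norms) ⟩
        (α₀ * α₀ ^ q) * x + α₀ ^ q * (α₁ * x ^ q)   ≈⟨ solve 5 (λ a A b B X → (a :* A) :* X :+ A :* b := A :* (b :+ a :* X))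
                                                          refl α₀ (α₀ ^ q) (α₁ * x ^ q) (α₀ ^ q) x ⟩
        α₀ ^ q * (α₁ * x ^ q + α₀ * x)              ∎

      module _ (_≟_ : Decidable _≈_) (rank : HasRank K q L 2) where
        open Rank2 rank

        rank-2⇒norms-unequal : α₁ * α₁ ^ q ≉ α₀ * α₀ ^ q
        rank-2⇒norms-unequal norms with α₁ ≟ 0# | α₀ ≟ 0#
        ... | no α₁≉0 | _ = basis-ratio-∉Fq (eigen-ratio-InFq α₁≉0 v₀≉0 (basis-eigen zero) (basis-eigen (suc zero)))
          where
          basis-eigen : ∀ i → α₁ * v i ^ q ≈ α₀ ^ q * v i
          basis-eigen i with z , Lz≈vᵢ ← basis-in-image i =
            trans (*-congˡ (^-congˡ q (sym Lz≈vᵢ))) (trans (norms-equal⇒image-eigen norms z) (*-congˡ Lz≈vᵢ))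
        ... | yes α₁≈0 | no α₀≉0 =
          *-nonzero α₀≉0 (^-nonzero q α₀≉0) (trans (sym norms) (trans (*-congʳ α₁≈0) (zeroˡ _)))
        ... | yes α₁≈0 | yes α₀≈0 with z , Lz≈v₀ ← basis-in-image zero =
          v₀≉0 (trans (sym Lz≈v₀) (trans (+-cong (trans (*-congʳ α₁≈0) (zeroˡ _)) (trans (*-congʳ α₀≈0) (zeroˡ z))) (+-identityʳ 0#)))

        rank-2⇒injective : ∀ {x y} → L x ≈ L y → x ≈ y
        rank-2⇒injective {x} {y} Lx≈Ly = x∙y⁻¹≈ε⇒x≈y x y (kernel-trivial (begin
          L (x - y)        ≈⟨ linearized-+ α₁ α₀ x (- y) ⟩
          L x + L (- y)    ≈⟨ +-congˡ (linearized-‿ α₁ α₀ y) ⟩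
          L x - L y        ≈⟨ x≈y⇒x∙y⁻¹≈ε Lx≈Ly ⟩
          0#               ∎))
          where
          kernel-trivial : ∀ {z} → L z ≈ 0# → z ≈ 0#
          kernel-trivial {z} Lz≈0 with z ≟ 0#
          ... | yes z≈0 = z≈0
          ... | no  z≉0 = contradiction (kernel-nontrivial⇒norms-equal z≉0 Lz≈0) rank-2⇒norms-unequal

    module _ (^q-^q : ∀ x → (x ^ q) ^ q ≈ x) {δ : Carrier} (δ-norm : δ ^ suc q ≈ 1#) where
      private
        s : Carrier → Carrier
        s = sPoly K q δ

        δᵠ*δ≈1 : δ ^ q * δ ≈ 1#
        δᵠ*δ≈1 = trans (*-comm _ δ) δ-norm

      sPoly-^q : ∀ w → s w ^ q ≈ δ ^ q * s w
      sPoly-^q w = begin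
        (w ^ q + δ * w) ^ q          ≈⟨ ^q-+ _ _ ⟩
        (w ^ q) ^ q + (δ * w) ^ q    ≈⟨ +-cong (^q-^q w) (^-distrib-* δ w q) ⟩
        w + δ ^ q * w ^ q            ≈⟨ +-comm _ _ ⟩
        δ ^ q * w ^ q + w            ≈⟨ +-congˡ (trans (sym (*-identityˡ w)) (*-congʳ (sym δᵠ*δ≈1))) ⟩
        δ ^ q * w ^ q + (δ ^ q * δ) * w
          ≈⟨ solve 4 (λ D X d x → D :* X :+ (D :* d) :* x := D :* (X :+ d :* x)) refl (δ ^ q) (w ^ q) δ w ⟩
        δ ^ q * (w ^ q + δ * w)      ∎

      sPoly-conjugate-kernel : ∀ u → s (u ^ q - δ ^ q * u) ≈ 0#
      sPoly-conjugate-kernel u = begin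
        (u ^ q - δ ^ q * u) ^ q + δ * (u ^ q - δ ^ q * u)  ≈⟨ +-cong first second ⟩
        (u + - (δ * u ^ q)) + (δ * u ^ q + - u)
          ≈⟨ solve 4 (λ a b na nb → (a :+ nb) :+ (b :+ na) := (a :+ na) :+ (b :+ nb)) refl u (δ * u ^ q) (- u) (- (δ * u ^ q)) ⟩
        (u + - u) + (δ * u ^ q + - (δ * u ^ q))            ≈⟨ +-cong (-‿inverseʳ u) (-‿inverseʳ _) ⟩
        0# + 0#                                             ≈⟨ +-identityʳ 0# ⟩
        0#                                                  ∎
        where
        first : (u ^ q - δ ^ q * u) ^ q ≈ u + - (δ * u ^ q)
        first = begin
          (u ^ q - δ ^ q * u) ^ q             ≈⟨ ^q-+ _ _ ⟩
          (u ^ q) ^ q + (- (δ ^ q * u)) ^ q   ≈⟨ +-cong (^q-^q u) (^q-‿ _) ⟩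
          u + - ((δ ^ q * u) ^ q)             ≈⟨ +-congˡ (-‿cong (trans (^-distrib-* _ u q) (*-congʳ (^q-^q δ)))) ⟩
          u + - (δ * u ^ q)                   ∎
        second : δ * (u ^ q - δ ^ q * u) ≈ δ * u ^ q + - u
        second = begin
          δ * (u ^ q - δ ^ q * u)             ≈⟨ distribˡ δ _ _ ⟩
          δ * u ^ q + δ * - (δ ^ q * u)       ≈⟨ +-congˡ (-‿distribʳ-* δ _) ⟨
          δ * u ^ q + - (δ * (δ ^ q * u))     ≈⟨ +-congˡ (-‿cong (trans (sym (*-assoc δ _ u)) (*-congʳ δ-norm))) ⟩
          δ * u ^ q + - (1# * u)              ≈⟨ +-congˡ (-‿cong (*-identityˡ u)) ⟩
          δ * u ^ q + - u                     ∎

      conjugate-kernel-trivial⇒all-InFq : (∀ u → u ^ q - δ ^ q * u ≈ 0#) → ∀ u → Fq u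
      conjugate-kernel-trivial⇒all-InFq trivial u = trans (uᵠ≈δᵠu u) (trans (*-congʳ δᵠ≈1) (*-identityˡ u))
        where
        uᵠ≈δᵠu : ∀ u → u ^ q ≈ δ ^ q * u
        uᵠ≈δᵠu u = x∙y⁻¹≈ε⇒x≈y _ _ (trivial u)
        δᵠ≈1 : δ ^ q ≈ 1#
        δᵠ≈1 = sym (trans (sym InFq-1) (trans (uᵠ≈δᵠu 1#) (*-identityʳ _)))

      sPoly-image-ratio-InFq : ∀ {λ₀} → (λ₀≉0 : λ₀ ≉ 0#) → (∃ λ z → s z ≈ λ₀) → ∀ x → Fq (s x * inv λ₀ λ₀≉0)
      sPoly-image-ratio-InFq {λ₀} λ₀≉0 (z , sz≈λ₀) x =
        eigen-ratio-InFq 1≉0 λ₀≉0 (eigen-at-image λ₀ (z , sz≈λ₀)) (eigen-at-image (s x) (x , refl))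
        where
        eigen-at-image : ∀ y → (∃ λ w → s w ≈ y) → 1# * y ^ q ≈ δ ^ q * y
        eigen-at-image y (w , sw≈y) =
          trans (*-identityˡ _) (trans (^-congˡ q (sym sw≈y)) (trans (sPoly-^q w) (*-congˡ sw≈y)))

module PermutationPolynomial {r ℓ} (K : CommutativeRing r ℓ) (F : IsField K)
         {N : ℕ} (enum : Bijection (≡.setoid (Fin N)) (CommutativeRing.setoid K)) (q : ℕ) where
  open CommutativeRing K hiding (zero)
  open FieldProperties K F
  open FiniteField K F enum using (_≟_; ¬∀⇒∃¬; injective⇒bijective)
  open LinearizedPolynomials K F q
  open RingProperties K
  open import Algebra.Properties.Semiring.Exp semiring
  open import Algebra.Properties.Ring ring using (-‿distribˡ-*; +-cancelˡ)
  open import Algebra.Solver.Ring.NaturalCoefficients commutativeSemiring (λ _ _ → nothing)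
  open import Relation.Binary.Reasoning.Setoid setoid

  module _ (^q-+ : ∀ x y → (x + y) ^ q ≈ x ^ q + y ^ q) (^q-^q : ∀ x → (x ^ q) ^ q ≈ x)
           {δ : Carrier} (δ-norm : δ ^ suc q ≈ 1#) where
    private
      s : Carrier → Carrier
      s = sPoly K q δ

    -- u^q − δ^q u always lies in ker s, and vanishes for every u only if K = F_q.
    sPoly-kernel-nontrivial : ¬ (∀ u → InFq K q u) → ∃ λ k → k ≉ 0# × s k ≈ 0#
    sPoly-kernel-nontrivial ¬all-InFq =
      let u , ≉0 = ¬∀⇒∃¬ conj-cong (λ u → conj u ≟ 0#) (λ all → ¬all-InFq (conjugate-kernel-trivial⇒all-InFq ^q-+ ^q-^q δ-norm all))
      in conj u , ≉0 , sPoly-conjugate-kernel ^q-+ ^q-^q δ-norm u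
      where
      conj : Carrier → Carrier
      conj u = u ^ q - δ ^ q * u
      conj-cong : ∀ {u v} → u ≈ v → conj u ≈ 0# → conj v ≈ 0#
      conj-cong u≈v = trans (+-cong (^-congˡ q (sym u≈v)) (-‿cong (*-congˡ (sym u≈v))))

    module _ {m : ℕ} (1≤m : 1 ℕ.≤ m) {a : ℕ → Carrier} (a-InFq : ∀ i → 2 ℕ.≤ i → i ℕ.< m → InFq K q (a i))
             {λ₀ : Carrier} (λ₀-image : ∃ λ z → s z ≈ λ₀)
             {α₁ α₀ : Carrier} (rank : HasRank K q (linearized K q α₁ α₀) 2)
             (L-kernel : ∀ x → s x ≈ 0# → ∃ λ e → InFq K q e × linearized K q α₁ α₀ x ≈ e * λ₀ ^ m) where
      private
        L : Carrier → Carrier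
        L = linearized K q α₁ α₀

        g : Carrier → Carrier
        g = gPoly K q m a λ₀

        G : Carrier → Carrier
        G = gPoly-dehomogenised m a

        L-injective : ∀ {x y} → L x ≈ L y → x ≈ y
        L-injective = rank-2⇒injective ^q-+ ^q-^q _≟_ rank

      f : Carrier → Carrier
      f x = g (s x) + L x

      private
        kernel-element : ∃ λ k → k ≉ 0# × s k ≈ 0#
        kernel-element = sPoly-kernel-nontrivial (Rank2.¬all-InFq ^q-+ rank)

        k₀ : Carrier
        k₀ = proj₁ kernel-element

        k₀≉0 : k₀ ≉ 0#
        k₀≉0 = proj₁ (proj₂ kernel-element)

        sk₀≈0 : s k₀ ≈ 0#
        sk₀≈0 = proj₂ (proj₂ kernel-element)

        e₀ : Carrier
        e₀ = proj₁ (L-kernel k₀ sk₀≈0)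

        e₀-InFq : InFq K q e₀
        e₀-InFq = proj₁ (proj₂ (L-kernel k₀ sk₀≈0))

        Lk₀≈e₀λᵐ : L k₀ ≈ e₀ * λ₀ ^ m
        Lk₀≈e₀λᵐ = proj₂ (proj₂ (L-kernel k₀ sk₀≈0))

        e₀λᵐ≉0 : e₀ * λ₀ ^ m ≉ 0#
        e₀λᵐ≉0 e₀λᵐ≈0 = k₀≉0 (L-injective (trans Lk₀≈e₀λᵐ (trans e₀λᵐ≈0 (sym (linearized-0 ^q-+ α₁ α₀)))))

        e₀≉0 : e₀ ≉ 0#
        e₀≉0 e₀≈0 = e₀λᵐ≉0 (trans (*-congʳ e₀≈0) (zeroˡ _))

        λ₀≉0 : λ₀ ≉ 0#
        λ₀≉0 λ₀≈0 = e₀λᵐ≉0 (trans (*-congˡ (λ₀ⁿ≈0 1≤m)) (zeroʳ e₀))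
          where
          λ₀ⁿ≈0 : ∀ {n} → 1 ℕ.≤ n → λ₀ ^ n ≈ 0#
          λ₀ⁿ≈0 {suc n} _ = trans (*-congʳ λ₀≈0) (zeroˡ _)

        t : Carrier → Carrier
        t x = s x * inv λ₀ λ₀≉0

        s≈tλ₀ : ∀ x → s x ≈ t x * λ₀
        s≈tλ₀ x = sym (trans (*-assoc _ _ λ₀) (trans (*-congˡ (inv-inverseˡ λ₀≉0)) (*-identityʳ _)))

        G-InFq : ∀ {u} → InFq K q u → InFq K q (G u)
        G-InFq uᵠ≈u = InFq-+ ^q-+ (InFq-^ m uᵠ≈u) (sumN-closed (InFq K q) (InFq-+ ^q-+) (InFq-0 ^q-+) (m ℕ.∸ 2) _
          (λ k k<m∸2 → InFq-* (a-InFq (2 ℕ.+ k) (ℕₚ.m≤m+n 2 k) (2+k<m {m} k<m∸2)) (InFq-^ (2 ℕ.+ k) uᵠ≈u)))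

        g-cong : ∀ {y z} → y ≈ z → g y ≈ g z
        g-cong = gPoly-cong q m a λ₀

        t-InFq : ∀ x → InFq K q (t x)
        t-InFq = sPoly-image-ratio-InFq ^q-+ ^q-^q δ-norm λ₀≉0 λ₀-image

        g∘s : ∀ x → g (s x) ≈ G (t x) * λ₀ ^ m
        g∘s x = trans (g-cong (s≈tλ₀ x)) (gPoly-homogeneous q m a λ₀ (t x))

        λᵐ-multiple≈L[k₀-multiple] : ∀ {E} → InFq K q E → ∃ λ c → InFq K q c × E * λ₀ ^ m ≈ L (c * k₀)
        λᵐ-multiple≈L[k₀-multiple] {E} Eᵠ≈E = c , c-InFq , (begin
          E * λ₀ ^ m                        ≈⟨ *-congʳ (*-identityʳ E) ⟨
          (E * 1#) * λ₀ ^ m                 ≈⟨ *-congʳ (*-congˡ (inv-inverseˡ e₀≉0)) ⟨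
          (E * (inv e₀ e₀≉0 * e₀)) * λ₀ ^ m ≈⟨ solve 4 (λ E i e l → (E :* (i :* e)) :* l := (E :* i) :* (e :* l)) refl E _ e₀ (λ₀ ^ m) ⟩
          c * (e₀ * λ₀ ^ m)                 ≈⟨ *-congˡ Lk₀≈e₀λᵐ ⟨
          c * L k₀                          ≈⟨ linearized-* ^q-+ α₁ α₀ k₀ c-InFq ⟨
          L (c * k₀)                        ∎)
          where
          c : Carrier
          c = E * inv e₀ e₀≉0
          c-InFq : InFq K q c
          c-InFq = InFq-* Eᵠ≈E (InFq-inv e₀≉0 e₀-InFq)

      f-injective : ∀ {x y} → f x ≈ f y → x ≈ y
      f-injective {x} {y} fx≈fy = L-injective (+-cancelˡ (g (s x)) (L x) (L y) (trans fx≈fy (+-congʳ (g-cong (sym sx≈sy)))))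
        where
        E : Carrier
        E = G (t y) - G (t x)

        E-InFq : InFq K q E
        E-InFq = InFq-+ ^q-+ (G-InFq (t-InFq y)) (InFq-‿ ^q-+ (G-InFq (t-InFq x)))

        Lx≈Ly+Eλᵐ : L x ≈ L y + E * λ₀ ^ m
        Lx≈Ly+Eλᵐ = begin
          L x                                            ≈⟨ +-transpose G[tx]λᵐ+Lx≈G[ty]λᵐ+Ly ⟩
          L y + (G (t y) * λ₀ ^ m - G (t x) * λ₀ ^ m)    ≈⟨ +-congˡ (+-congˡ (-‿distribˡ-* _ _)) ⟩
          L y + (G (t y) * λ₀ ^ m + - G (t x) * λ₀ ^ m)  ≈⟨ +-congˡ (distribʳ _ _ _) ⟨
          L y + E * λ₀ ^ m                               ∎
          where
          G[tx]λᵐ+Lx≈G[ty]λᵐ+Ly : G (t x) * λ₀ ^ m + L x ≈ G (t y) * λ₀ ^ m + L y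
          G[tx]λᵐ+Lx≈G[ty]λᵐ+Ly = trans (+-congʳ (sym (g∘s x))) (trans fx≈fy (+-congʳ (g∘s y)))

        x≈y+ck₀ : ∀ c → E * λ₀ ^ m ≈ L (c * k₀) → x ≈ y + c * k₀
        x≈y+ck₀ c Eλᵐ≈Lck₀ = L-injective (begin
          L x               ≈⟨ Lx≈Ly+Eλᵐ ⟩
          L y + E * λ₀ ^ m  ≈⟨ +-congˡ Eλᵐ≈Lck₀ ⟩
          L y + L (c * k₀)  ≈⟨ linearized-+ ^q-+ α₁ α₀ y (c * k₀) ⟨
          L (y + c * k₀)    ∎)

        sx≈sy : s x ≈ s y
        sx≈sy = let c , c-InFq , Eλᵐ≈Lck₀ = λᵐ-multiple≈L[k₀-multiple] E-InFq in begin
          s x                ≈⟨ sPoly-cong ^q-+ δ (x≈y+ck₀ c Eλᵐ≈Lck₀) ⟩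
          s (y + c * k₀)     ≈⟨ sPoly-+ ^q-+ δ y (c * k₀) ⟩
          s y + s (c * k₀)   ≈⟨ +-congˡ (sPoly-* ^q-+ δ k₀ c-InFq) ⟩
          s y + c * s k₀     ≈⟨ +-congˡ (trans (*-congˡ sk₀≈0) (zeroʳ c)) ⟩
          s y + 0#           ≈⟨ +-identityʳ _ ⟩
          s y                ∎

      f-bijective : IsPermutation K f
      f-bijective = injective⇒bijective f f-cong f-injective
        where
        f-cong : ∀ {x y} → x ≈ y → f x ≈ f y
        f-cong x≈y = +-cong (g-cong (sPoly-cong ^q-+ δ x≈y)) (linearized-cong ^q-+ α₁ α₀ x≈y)

corollary3 : {c ℓ : Level} (K : CommutativeRing c ℓ) (q : ℕ) →
    IsPrimePower q → IsField K → HasCardinality K (q ℕ.^ 2) →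
    (δ : CommutativeRing.Carrier K) →
    CommutativeRing._≈_ K (pow K δ (suc q)) (CommutativeRing.1# K) →
    (m : ℕ) → 1 ℕ.≤ m →
    (a : ℕ → CommutativeRing.Carrier K) →
    (∀ i → 2 ℕ.≤ i → i ℕ.< m → InFq K q (a i)) →
    (λ₀ : CommutativeRing.Carrier K) →
    (∃ λ z → CommutativeRing._≈_ K (sPoly K q δ z) λ₀) →
    (α₁ α₀ : CommutativeRing.Carrier K) →
    HasRank K q (linearized K q α₁ α₀) 2 →
    (∀ x → CommutativeRing._≈_ K (sPoly K q δ x) (CommutativeRing.0# K) →
      ∃ λ e → InFq K q e ×
        CommutativeRing._≈_ K (linearized K q α₁ α₀ x) (CommutativeRing._*_ K e (pow K λ₀ m))) →
    IsPermutation K (λ x → CommutativeRing._+_ K (gPoly K q m a λ₀ (sPoly K q δ x)) (linearized K q α₁ α₀ x))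
corollary3 K q (p , k , p-prime , _ , q≡pᵏ) F card δ δ-norm m 1≤m a a-InFq λ₀ λ₀-image α₁ α₀ rank L-kernel =
  PermutationPolynomial.f-bijective K F card q ^q-+ ^q-^q δ-norm 1≤m a-InFq λ₀-image rank L-kernel
  where
  open CommutativeRing K
  open FiniteField K F card using (prime-power-card⇒char; fermat)
  open import Algebra.Properties.Semiring.Exp semiring using (_^_; ^-assocʳ; ^-congʳ)

  q²≡p^[k*2] : q ℕ.^ 2 ≡ p ℕ.^ (k ℕ.* 2)
  q²≡p^[k*2] = ≡.trans (≡.cong (ℕ._^ 2) q≡pᵏ) (ℕₚ.^-*-assoc p k 2)

  ^q-+ : ∀ x y → (x + y) ^ q ≈ x ^ q + y ^ q
  ^q-+ = ≡.subst (λ n → ∀ x y → (x + y) ^ n ≈ x ^ n + y ^ n) (≡.sym q≡pᵏ)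
                 (RingProperties.^p^j-+ K p-prime (prime-power-card⇒char {p} {k ℕ.* 2} q²≡p^[k*2]) k)

  ^q-^q : ∀ x → (x ^ q) ^ q ≈ x
  ^q-^q x = trans (^-assocʳ x q q) (trans (^-congʳ x (≡.cong (q ℕ.*_) (≡.sym (ℕₚ.*-identityʳ q)))) (fermat x))
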